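{- Let $\Gamma=(V,E)$ be a directed strongly regular graph with parameters $(v,k,t,\lambda,\mu)$ and adjacency matrix $A$, and let $G$ be a group of automorphisms of $\Gamma$ whose orbits on $V$ are $O_1,\dots,O_b$ with sizes $n_1,\dots,n_b$. Partition $A=[A_{ij}]$ and $W=A^2=[W_{ij}]$ into blocks, where the rows of the blocks $A_{ij}$, $W_{ij}$ are indexed by $O_i$ and the columns by $O_j$. Let $C=[c_{ij}]$ and $R=[r_{ij}]$ be the $b\times b$ matrices where $c_{ij}$ is the (constant) column sum of $A_{ij}$ and $r_{ij}$ is the (constant) row sum of $A_{ij}$, let $N=\mathrm{diag}(n_1,\dots,n_b)$, and let $S=[s_{ij}]$ be the $b\times b$ matrix where $s_{ij}$ is the sum of all entries of $W_{ij}$. Then $CNR=S$.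
   Context: A directed strongly regular graph with parameters $(v,k,t,\lambda,\mu)$ is a loopless directed graph $\Gamma=(V,E)$ on $v$ vertices in which every vertex has in-degree and out-degree $k$, every vertex $x$ has exactly $t$ out-neighbors that are also in-neighbors of $x$, and for any vertices $x,y$ the number of directed paths of length two from $x$ to $y$ is $\lambda$ if $(x,y)\in E$ and $\mu$ if $(x,y)\notin E$. Its adjacency matrix $A=[a_{xy}]$ has $a_{xy}=1$ if $(x,y)\in E$ and $0$ otherwise. An automorphism is a permutation $\sigma$ of $V$ with $(x,y)\in E\iff(\sigma(x),\sigma(y))\in E$. The matrix $C$ is called the column orbit matrix and $R$ the row orbit matrix of $\Gamma$ with respect to $G$. -}

module Defs where

open import Data.Nat using (ℕ; zero; suc; _+_; _*_)
open import Data.Bool using (Bool; true; false; if_then_else_)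
open import Data.Fin using (Fin; _≟_)

open import Data.Fin.Permutation using (Permutation′; _⟨$⟩ʳ_; id; flip; _∘ₚ_)
open import Data.Product using (_×_; ∃; ∃-syntax)
open import Relation.Nullary using (does)
open import Relation.Binary.PropositionalEquality using (_≡_)

∑[_]_ : (n : ℕ) → (Fin n → ℕ) → ℕ
∑[ zero ] f = 0
∑[ suc n ] f = f Fin.zero + ∑[ n ] (λ i → f (Fin.suc i))

adj : {v : ℕ} → (Fin v → Fin v → Bool) → Fin v → Fin v → ℕ
adj E x y = if E x y then 1 else 0

_⊗_ : {v : ℕ} → (Fin v → Fin v → ℕ) → (Fin v → Fin v → ℕ) → Fin v → Fin v → ℕ
_⊗_ {v} M P x y = ∑[ v ] (λ z → M x z * P z y)

[_≡ᶠ_] : {b : ℕ} → Fin b → Fin b → ℕ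
[ i ≡ᶠ j ] = if does (i ≟ j) then 1 else 0

record IsDSRG (v k t lam mu : ℕ) (E : Fin v → Fin v → Bool) : Set where
  field
    loopless  : ∀ x → E x x ≡ false
    outDegree : ∀ x → ∑[ v ] (λ y → adj E x y) ≡ k
    inDegree  : ∀ y → ∑[ v ] (λ x → adj E x y) ≡ k
    mutual-t  : ∀ x → ∑[ v ] (λ y → adj E x y * adj E y x) ≡ t
    paths2    : ∀ x y → ∑[ v ] (λ z → adj E x z * adj E z y)
                          ≡ (if E x y then lam else mu)

IsAutomorphism : {v : ℕ} → (Fin v → Fin v → Bool) → Permutation′ v → Set
IsAutomorphism E σ = ∀ x y → E (σ ⟨$⟩ʳ x) (σ ⟨$⟩ʳ y) ≡ E x y

record IsAutGroup {v : ℕ} (E : Fin v → Fin v → Bool) (G : Permutation′ v → Set) : Set₁ where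
  field
    auts     : ∀ σ → G σ → IsAutomorphism E σ
    has-id   : G id
    closed-∘ : ∀ σ τ → G σ → G τ → G (σ ∘ₚ τ)
    closed-⁻¹ : ∀ σ → G σ → G (flip σ)

record IsOrbitLabelling {v b : ℕ} (G : Permutation′ v → Set) (orb : Fin v → Fin b) : Set where
  field
    onto       : ∀ i → ∃[ x ] orb x ≡ i
    sameOrbit⇒ : ∀ x y → orb x ≡ orb y → ∃[ σ ] (G σ × σ ⟨$⟩ʳ x ≡ y)
    ⇒sameOrbit : ∀ σ x → G σ → orb (σ ⟨$⟩ʳ x) ≡ orb x

orbitSize : {v b : ℕ} → (Fin v → Fin b) → Fin b → ℕ
orbitSize {v} orb i = ∑[ v ] (λ x → [ orb x ≡ᶠ i ])

blockSum : {v b : ℕ} → (Fin v → Fin b) → (Fin v → Fin v → ℕ) → Fin b → Fin b → ℕ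
blockSum {v} orb W i j = ∑[ v ] (λ x → ∑[ v ] (λ y → [ orb x ≡ᶠ i ] * [ orb y ≡ᶠ j ] * W x y))

IsColumnOrbitMatrix : {v b : ℕ} → (Fin v → Fin b) → (Fin v → Fin v → ℕ) → (Fin b → Fin b → ℕ) → Set
IsColumnOrbitMatrix {v} orb A C =
  ∀ i y → ∑[ v ] (λ x → [ orb x ≡ᶠ i ] * A x y) ≡ C i (orb y)

IsRowOrbitMatrix : {v b : ℕ} → (Fin v → Fin b) → (Fin v → Fin v → ℕ) → (Fin b → Fin b → ℕ) → Set
IsRowOrbitMatrix {v} orb A R =
  ∀ x j → ∑[ v ] (λ y → [ orb y ≡ᶠ j ] * A x y) ≡ R (orb x) j

{-# OPTIONS --safe #-}
-- Counting the 2-paths x → z → y with x ∈ O_i and y ∈ O_j by their middle vertex z gives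
-- s_ij = Σ_z c_{i,orb z} r_{orb z,j}, and grouping the middle vertices by orbit gives
-- Σ_l c_il n_l r_lj.
module Submission where

open import Defs
open import Data.Nat using (ℕ; zero; suc; _*_; _+_)
open import Data.Nat.Properties using (+-*-semiring; *-assoc; *-comm; *-identityˡ; +-identityʳ; [m*n]*[o*p]≡[m*o]*[n*p])
open import Data.Bool using (Bool)
open import Data.Fin using (Fin)
open import Data.Fin.Permutation using (Permutation′)
open import Function using (_∘_; flip)
open import Relation.Binary.PropositionalEquality
import Algebra.Properties.Semiring.Sum +-*-semiring as Sum

Matrix : ℕ → Set
Matrix v = Fin v → Fin v → ℕ

∑≡sum : ∀ n (f : Fin n → ℕ) → ∑[ n ] f ≡ Sum.sum f
∑≡sum zero    f = refl
∑≡sum (suc n) f = cong (f Fin.zero +_) (∑≡sum n (f ∘ Fin.suc))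

∑-cong : ∀ n {f g : Fin n → ℕ} → f ≗ g → ∑[ n ] f ≡ ∑[ n ] g
∑-cong n {f} {g} f≗g rewrite ∑≡sum n f | ∑≡sum n g = Sum.sum-cong-≗ f≗g

∑-zero : ∀ n → ∑[ n ] (λ _ → 0) ≡ 0
∑-zero n = trans (∑≡sum n _) (Sum.sum-replicate-zero n)

*-distribˡ-∑ : ∀ n c (f : Fin n → ℕ) → c * ∑[ n ] f ≡ ∑[ n ] (λ i → c * f i)
*-distribˡ-∑ n c f rewrite ∑≡sum n f | ∑≡sum n (λ i → c * f i) = Sum.*-distribˡ-sum c f

*-distribʳ-∑ : ∀ n c (f : Fin n → ℕ) → ∑[ n ] f * c ≡ ∑[ n ] (λ i → f i * c)
*-distribʳ-∑ n c f rewrite ∑≡sum n f | ∑≡sum n (λ i → f i * c) = Sum.*-distribʳ-sum c f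

∑∑≡sum-sum : ∀ m n (f : Fin m → Fin n → ℕ) →
  ∑[ m ] (λ i → ∑[ n ] (f i)) ≡ Sum.sum (λ i → Sum.sum (f i))
∑∑≡sum-sum m n f = trans (∑-cong m (λ i → ∑≡sum n (f i))) (∑≡sum m _)

∑-comm : ∀ m n (f : Fin m → Fin n → ℕ) →
  ∑[ m ] (λ i → ∑[ n ] (f i)) ≡ ∑[ n ] (λ j → ∑[ m ] (λ i → f i j))
∑-comm m n f = trans (∑∑≡sum-sum m n f) (trans (Sum.∑-comm f) (sym (∑∑≡sum-sum n m (flip f))))

∑-*-∑ : ∀ m n (f : Fin m → ℕ) (g : Fin n → ℕ) →
  ∑[ m ] f * ∑[ n ] g ≡ ∑[ m ] (λ i → ∑[ n ] (λ j → f i * g j))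
∑-*-∑ m n f g = trans (*-distribʳ-∑ m (∑[ n ] g) f) (∑-cong m (λ i → *-distribˡ-∑ n (f i) g))

∑-indicator : ∀ b (a : Fin b) (g : Fin b → ℕ) → ∑[ b ] (λ l → [ a ≡ᶠ l ] * g l) ≡ g a
∑-indicator (suc b) Fin.zero    g = trans (cong₂ _+_ (*-identityˡ (g Fin.zero)) (∑-zero b)) (+-identityʳ _)
∑-indicator (suc b) (Fin.suc a) g = ∑-indicator b a (g ∘ Fin.suc)

∑-by-fibres : ∀ {v b} (orb : Fin v → Fin b) (f : Fin b → ℕ) →
  ∑[ v ] (λ z → f (orb z)) ≡ ∑[ b ] (λ l → orbitSize orb l * f l)
∑-by-fibres {v} {b} orb f = begin
  ∑[ v ] (λ z → f (orb z))                               ≡⟨ ∑-cong v (λ z → sym (∑-indicator b (orb z) f)) ⟩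
  ∑[ v ] (λ z → ∑[ b ] (λ l → [ orb z ≡ᶠ l ] * f l))     ≡⟨ ∑-comm v b _ ⟩
  ∑[ b ] (λ l → ∑[ v ] (λ z → [ orb z ≡ᶠ l ] * f l))     ≡⟨ ∑-cong b (λ l → sym (*-distribʳ-∑ v (f l) _)) ⟩
  ∑[ b ] (λ l → orbitSize orb l * f l)                   ∎
  where open ≡-Reasoning

blockColumnSum : ∀ {v b} → (Fin v → Fin b) → Matrix v → Fin b → Fin v → ℕ
blockColumnSum {v} orb A i y = ∑[ v ] (λ x → [ orb x ≡ᶠ i ] * A x y)

blockRowSum : ∀ {v b} → (Fin v → Fin b) → Matrix v → Fin v → Fin b → ℕ
blockRowSum {v} orb A x j = ∑[ v ] (λ y → [ orb y ≡ᶠ j ] * A x y)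

blockSum-⊗ : ∀ {v b} (orb : Fin v → Fin b) (A B : Matrix v) i j →
  blockSum orb (A ⊗ B) i j ≡ ∑[ v ] (λ z → blockColumnSum orb A i z * blockRowSum orb B z j)
blockSum-⊗ {v} {b} orb A B i j = begin
  ∑[ v ] (λ x → ∑[ v ] (λ y → [ x ∈ i ] * [ y ∈ j ] * ∑[ v ] (λ z → A x z * B z y)))
    ≡⟨ ∑-cong v (λ x → ∑-cong v (λ y → separate x y)) ⟩
  ∑[ v ] (λ x → ∑[ v ] (λ y → ∑[ v ] (λ z → [ x ∈ i ] * A x z * ([ y ∈ j ] * B z y))))
    ≡⟨ ∑-cong v (λ x → ∑-comm v v _) ⟩
  ∑[ v ] (λ x → ∑[ v ] (λ z → ∑[ v ] (λ y → [ x ∈ i ] * A x z * ([ y ∈ j ] * B z y))))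
    ≡⟨ ∑-comm v v _ ⟩
  ∑[ v ] (λ z → ∑[ v ] (λ x → ∑[ v ] (λ y → [ x ∈ i ] * A x z * ([ y ∈ j ] * B z y))))
    ≡⟨ ∑-cong v (λ z → sym (∑-*-∑ v v _ _)) ⟩
  ∑[ v ] (λ z → blockColumnSum orb A i z * blockRowSum orb B z j)
    ∎
  where
  open ≡-Reasoning
  [_∈_] : Fin v → Fin b → ℕ
  [ x ∈ i ] = [ orb x ≡ᶠ i ]
  separate : ∀ x y → [ x ∈ i ] * [ y ∈ j ] * ∑[ v ] (λ z → A x z * B z y)
                   ≡ ∑[ v ] (λ z → [ x ∈ i ] * A x z * ([ y ∈ j ] * B z y))
  separate x y = trans (*-distribˡ-∑ v ([ x ∈ i ] * [ y ∈ j ]) (λ z → A x z * B z y))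
    (∑-cong v (λ z → [m*n]*[o*p]≡[m*o]*[n*p] [ x ∈ i ] [ y ∈ j ] (A x z) (B z y)))

blockSum-⊗-orbitMatrices : ∀ {v b} (orb : Fin v → Fin b) (A B : Matrix v) (C R : Fin b → Fin b → ℕ) →
  IsColumnOrbitMatrix orb A C → IsRowOrbitMatrix orb B R →
  ∀ i j → ∑[ b ] (λ l → C i l * orbitSize orb l * R l j) ≡ blockSum orb (A ⊗ B) i j
blockSum-⊗-orbitMatrices {v} {b} orb A B C R hC hR i j = begin
  ∑[ b ] (λ l → C i l * orbitSize orb l * R l j)
    ≡⟨ ∑-cong b (λ l → m*n*o≡n*[m*o] (C i l) (orbitSize orb l) (R l j)) ⟩
  ∑[ b ] (λ l → orbitSize orb l * (C i l * R l j))
    ≡⟨ sym (∑-by-fibres orb (λ l → C i l * R l j)) ⟩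
  ∑[ v ] (λ z → C i (orb z) * R (orb z) j)
    ≡⟨ ∑-cong v (λ z → sym (cong₂ _*_ (hC i z) (hR z j))) ⟩
  ∑[ v ] (λ z → blockColumnSum orb A i z * blockRowSum orb B z j)
    ≡⟨ sym (blockSum-⊗ orb A B i j) ⟩
  blockSum orb (A ⊗ B) i j
    ∎
  where
  open ≡-Reasoning
  m*n*o≡n*[m*o] : ∀ m n o → m * n * o ≡ n * (m * o)
  m*n*o≡n*[m*o] m n o = trans (cong (_* o) (*-comm m n)) (*-assoc n m o)

proposition2p1 : (v k t lam mu b : ℕ) (E : Fin v → Fin v → Bool) → IsDSRG v k t lam mu E →
    (G : Permutation′ v → Set) → IsAutGroup E G →
    (orb : Fin v → Fin b) → IsOrbitLabelling G orb →
    (C R : Fin b → Fin b → ℕ) → IsColumnOrbitMatrix orb (adj E) C → IsRowOrbitMatrix orb (adj E) R →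
    ∀ i j → ∑[ b ] (λ l → C i l * orbitSize orb l * R l j)
              ≡ blockSum orb (adj E ⊗ adj E) i j
proposition2p1 v k t lam mu b E _ G _ orb _ C R hC hR =
  blockSum-⊗-orbitMatrices orb (adj E) (adj E) C R hC hR
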